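{- Let $d\ge1$ and let $Z$ be a subdivided $d$-SMNBP. Let $P$ be a source-sink path of $Z$ that is not read-once, and let $v$ and $w$ be the pre-pivot and the pivot of $P$, respectively. Then $Z_v$, regarded as a branching program with source $v$ and the sink of $Z$ as sink, is a subdivided $(d-1)$-SMNBP.
   Context: An NBP is a directed acyclic graph, multiple edges allowed, with one source and one sink, some of whose edges are labelled with literals. A path is read-once if no two of its edges are labelled with the same variable. A $d$-SMNBP is an NBP with no negative literal labels in which along every path each variable labels at most $d$ edges, and every source-sink path can be partitioned into at most $d$ edge-disjoint consecutive read-once subpaths. A junction vertex is a vertex with in-degree or out-degree greater than one (counting parallel edges); otherwise it is a subdivision vertex. The program is subdivided if no edge joins two junction vertices and both endpoints of every labelled edge are subdivision vertices. A vertex $u$ is read-once if every path from the source to $u$ is read-once, and non-read-once otherwise. For a source-sink path $P$ that is not read-once, the pivot of $P$ is the first vertex of $P$ (the one closest to the source along $P$) that is non-read-once, and the pre-pivot is the vertex immediately preceding the pivot on $P$. $Z_v$ is the subgraph of $Z$ induced by $v$ and all vertices reachable from $v$, with labels preserved. -}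

module Defs where

open import Level using (0ℓ)
open import Data.Nat using (ℕ; zero; suc; _≤_; _≟_)
open import Data.Bool using (Bool; true; false)
open import Data.Fin using (Fin)
open import Data.Maybe using (Maybe; just; nothing)
open import Data.Product using (Σ; Σ-syntax; ∃; ∃-syntax; _×_; _,_; proj₁; proj₂)
open import Data.Sum using (_⊎_)
open import Data.List using (List; []; _∷_; _++_; map; concat; length; mapMaybe)
open import Data.List.Relation.Unary.All using (All)
open import Data.List.Relation.Unary.Unique.Propositional using (Unique)
open import Data.Irrelevant using (Irrelevant; [_])
open import Function.Bundles using (_↔_)
open import Relation.Nullary using (¬_; yes; no)
open import Relation.Binary.PropositionalEquality using (_≡_; _≢_; refl; subst; sym)

-- Literals: a variable (a natural number) with a polarity
-- (true = positive literal x, false = negative literal ¬x).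

Literal : Set
Literal = ℕ × Bool

record Graph : Set₁ where
  field
    V   : Set
    E   : Set
    src : E → V
    tgt : E → V
    lab : E → Maybe Literal

open Graph public

Finite : Set → Set
Finite X = Σ[ n ∈ ℕ ] (Fin n ↔ X)

module _ (G : Graph) where

  data Path : V G → V G → Set where
    nil  : ∀ {u} → Path u u
    cons : ∀ {u w} (e : E G) → src G e ≡ u → Path (tgt G e) w → Path u w

  edges : ∀ {u w} → Path u w → List (E G)
  edges nil          = []
  edges (cons e _ p) = e ∷ edges p

  verts : ∀ {u w} → Path u w → List (V G)
  verts {u} p = u ∷ map (tgt G) (edges p)

  _++ᴾ_ : ∀ {u x w} → Path u x → Path x w → Path u w
  nil          ++ᴾ q = q
  cons e eq p  ++ᴾ q = cons e eq (p ++ᴾ q)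

  varOf : E G → Maybe ℕ
  varOf e with lab G e
  ... | nothing      = nothing
  ... | just (x , _) = just x

  ReadOnceList : List (E G) → Set
  ReadOnceList es = Unique (mapMaybe varOf es)

  ReadOncePath : ∀ {u w} → Path u w → Set
  ReadOncePath p = ReadOnceList (edges p)

  varCount : ℕ → List (E G) → ℕ
  varCount x []       = 0
  varCount x (e ∷ es) with varOf e
  ... | nothing = varCount x es
  ... | just y with x ≟ y
  ...   | yes _ = suc (varCount x es)
  ...   | no  _ = varCount x es

  -- junction / subdivision vertices (degrees count parallel edges)
  Junction : V G → Set
  Junction u =
      (Σ[ e₁ ∈ E G ] Σ[ e₂ ∈ E G ] (e₁ ≢ e₂ × tgt G e₁ ≡ u × tgt G e₂ ≡ u))
    ⊎ (Σ[ e₁ ∈ E G ] Σ[ e₂ ∈ E G ] (e₁ ≢ e₂ × src G e₁ ≡ u × src G e₂ ≡ u))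

  SubdivisionVertex : V G → Set
  SubdivisionVertex u = ¬ Junction u

  Subdivided : Set
  Subdivided =
      (∀ e → ¬ (Junction (src G e) × Junction (tgt G e)))
    × (∀ e ℓ → lab G e ≡ just ℓ →
         SubdivisionVertex (src G e) × SubdivisionVertex (tgt G e))

  record IsNBP (s t : V G) : Set where
    field
      finiteV   : Finite (V G)
      finiteE   : Finite (E G)
      acyclic   : ∀ {u} (p : Path u u) → edges p ≡ []
      s-source  : ∀ e → tgt G e ≢ s
      s-unique  : ∀ u → (∀ e → tgt G e ≢ u) → u ≡ s
      t-sink    : ∀ e → src G e ≢ t
      t-unique  : ∀ u → (∀ e → src G e ≢ u) → u ≡ t

  record IsSMNBP (d : ℕ) (s t : V G) : Set where
    field
      nbp        : IsNBP s t
      monotone   : ∀ e x → lab G e ≢ just (x , false)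
      bounded    : ∀ {u w} (p : Path u w) (x : ℕ) → varCount x (edges p) ≤ d
      partition  : (p : Path s t) →
                   Σ[ ps ∈ List (List (E G)) ]
                     (concat ps ≡ edges p × length ps ≤ d × All ReadOnceList ps)

  ReadOnceVertex : V G → V G → Set
  ReadOnceVertex s u = (p : Path s u) → ReadOncePath p

  record PivotSplit {s t : V G} (P : Path s t) (v w : V G) : Set where
    field
      P₁       : Path s v
      e        : E G
      e-src    : src G e ≡ v
      e-tgt    : tgt G e ≡ w
      P₂       : Path w t
      decomp   : edges P ≡ edges P₁ ++ (e ∷ edges P₂)
      before   : All (ReadOnceVertex s) (verts P₁)
      pivotNRO : ¬ ReadOnceVertex s w

  tail : ∀ {s t v w} {P : Path s t} → PivotSplit P v w → Path v t
  tail sp = cons e e-src (subst (λ x → Path x _) (sym e-tgt) P₂)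
    where open PivotSplit sp

  reachStep : ∀ {v} (e : E G) → Path v (src G e) → Path v (tgt G e)
  reachStep e p = p ++ᴾ cons e refl nil

-- Reachability proofs are irrelevant, so vertices and
-- edges of Z_v are determined by the underlying vertices/edges of Z.
Sub : (G : Graph) → V G → Graph
Sub G v = record
  { V   = Σ[ x ∈ V G ] Irrelevant (Path G v x)
  ; E   = Σ[ e ∈ E G ] Irrelevant (Path G v (src G e))
  ; src = λ { (e , r) → src G e , r }
  ; tgt = λ { (e , r) → tgt G e , Data.Irrelevant.map (reachStep G e) r }
  ; lab = λ { (e , _) → lab G e }
  }

-- Since Z is subdivided, the pre-pivot v is a subdivision vertex whose only out-edge is the
-- pivot edge e, so every v–sink path is e·T.  Fix a non-read-once path Q to the pivot w.  If e is
-- unlabelled, partition the source–sink path Q·T into d read-once pieces: the non-read-once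
-- prefix Q swallows a whole piece, leaving at most d − 1 pieces for T, and e can join the first
-- of them.  If e is labelled, w is a subdivision vertex, so Q = Q₀·e and the same argument on
-- Q₀·e·T leaves at most d − 1 pieces for e·T.  Every path of Z_v extends to a v–sink path, which
-- bounds the multiplicity of each variable by d − 1; the remaining properties pass to Z_v
-- because it is closed under reachability.

module Submission where

open import Defs
open import Data.Empty using (⊥; ⊥-elim; ⊥-elim-irr)
open import Data.Fin using (Fin; zero; suc)
import Data.Fin.Properties as Fin
open import Data.Irrelevant using (Irrelevant; [_])
open import Data.List using (List; []; _∷_; _++_; map; concat; length; mapMaybe; take; lookup)
open import Data.List.Membership.Propositional using (_∈_)
open import Data.List.Membership.Propositional.Properties using (∈-lookup)
open import Data.List.Properties
  using (∷-injective; ++-assoc; ++-identityʳ; ++-conicalʳ; length-map; mapMaybe-++; mapMaybe-map; mapMaybe-cong)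
open import Data.List.Relation.Unary.All as All using (All; []; _∷_)
import Data.List.Relation.Unary.All.Properties as All
open import Data.List.Relation.Unary.Any using (here; there)
open import Data.List.Relation.Unary.AllPairs using ([]; _∷_)
open import Data.List.Relation.Unary.Unique.Propositional using (Unique)
open import Data.Maybe using (just; nothing)
open import Data.Nat using (ℕ; zero; suc; _+_; _∸_; _≤_; _<_; z≤n; s≤s; _≤?_; _≟_)
open import Data.Nat.Properties
  using (≤-trans; ≤-refl; ≤-reflexive; n≤1+n; m≤m+n; m≤n+m; +-mono-≤; ∸-monoˡ-≤; ≤-pred; module ≤-Reasoning)
open import Data.List.Relation.Unary.Unique.DecPropositional _≟_ using (unique?)
open import Data.Product using (Σ; Σ-syntax; ∃; ∃₂; _,_; _×_; proj₁; proj₂)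
import Data.Product as Product
open import Data.Product.Function.Dependent.Propositional using (Σ-↔)
open import Data.Sum using (_⊎_; inj₁; inj₂)
open import Function using (_∘_; id)
open import Function.Bundles using (Inverse; Injection; mk↔ₛ′)
open import Function.Properties.Inverse using (↔-refl; ↔-sym; ↔-trans; ↔⇒↣)
open import Relation.Binary.Definitions using (DecidableEquality)
open import Relation.Binary.PropositionalEquality
  using (_≡_; _≢_; refl; sym; trans; cong; subst; module ≡-Reasoning)
open import Relation.Nullary using (¬_; Dec; yes; no)
open import Relation.Nullary.Decidable using (map′; _×-dec_; _⊎-dec_; decidable-stable; recompute)
open import Relation.Unary using (Decidable)

finite-≟ : {X : Set} → Finite X → DecidableEquality X
finite-≟ (_ , Fin↔X) = Fin.inj⇒≟ (↔⇒↣ (↔-sym Fin↔X))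

finite-∃? : {X : Set} {P : X → Set} → Finite X → Decidable P → Dec (∃ P)
finite-∃? {P = P} (_ , Fin↔X) P? =
  map′ (λ (i , p) → to i , p) (λ (x , p) → from x , subst P (sym (strictlyInverseˡ x)) p) (Fin.any? (P? ∘ to))
  where open Inverse Fin↔X

Σ-irrelevant-≡ : {X : Set} {P : X → Set} {x y : X} → x ≡ y → (p : Irrelevant (P x)) (q : Irrelevant (P y)) →
                 _≡_ {A = Σ X (Irrelevant ∘ P)} (x , p) (y , q)
Σ-irrelevant-≡ refl _ _ = refl

Fin-Σ-irrelevant-finite : ∀ n {Q : Fin n → Set} → Decidable Q → Finite (Σ (Fin n) (Irrelevant ∘ Q))
Fin-Σ-irrelevant-finite zero Q? = 0 , mk↔ₛ′ (λ ()) (λ { (() , _) }) (λ { (() , _) }) (λ ())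
Fin-Σ-irrelevant-finite (suc n) {Q} Q? with Fin-Σ-irrelevant-finite n (Q? ∘ suc) | Q? zero
... | m , m↔ | yes q = suc m , mk↔ₛ′ to′ from′ to∘from from∘to
  where
  open Inverse m↔
  to′ : Fin (suc m) → Σ (Fin (suc n)) (Irrelevant ∘ Q)
  to′ zero    = zero , [ q ]
  to′ (suc k) = Product.map suc id (to k)
  from′ : Σ (Fin (suc n)) (Irrelevant ∘ Q) → Fin (suc m)
  from′ (zero  , _) = zero
  from′ (suc i , r) = suc (from (i , r))
  to∘from : ∀ y → to′ (from′ y) ≡ y
  to∘from (zero  , _) = refl
  to∘from (suc i , r) = cong (Product.map suc id) (strictlyInverseˡ (i , r))
  from∘to : ∀ k → from′ (to′ k) ≡ k
  from∘to zero    = refl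
  from∘to (suc k) = cong suc (strictlyInverseʳ k)
... | m , m↔ | no ¬q = m , mk↔ₛ′ (Product.map suc id ∘ to) from′ to∘from strictlyInverseʳ
  where
  open Inverse m↔
  from′ : Σ (Fin (suc n)) (Irrelevant ∘ Q) → Fin m
  from′ (zero  , [ q ]) = ⊥-elim-irr (¬q q)
  from′ (suc i , r)     = from (i , r)
  to∘from : ∀ y → Product.map suc id (to (from′ y)) ≡ y
  to∘from (zero  , [ q ]) = ⊥-elim-irr (¬q q)
  to∘from (suc i , r)     = cong (Product.map suc id) (strictlyInverseˡ (i , r))

Σ-irrelevant-finite : {X : Set} {P : X → Set} → Finite X → Decidable P → Finite (Σ X (Irrelevant ∘ P))
Σ-irrelevant-finite (n , Fin↔X) P? with Fin-Σ-irrelevant-finite n (P? ∘ Inverse.to Fin↔X)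
... | m , m↔ = m , ↔-trans m↔ (Σ-↔ Fin↔X ↔-refl)

Unique-lookup-injective : {X : Set} {xs : List X} → Unique xs → ∀ {i j} → lookup xs i ≡ lookup xs j → i ≡ j
Unique-lookup-injective (_  ∷ _) {zero}  {zero}  _  = refl
Unique-lookup-injective (x∉ ∷ _) {zero}  {suc j} eq = ⊥-elim (All.lookup x∉ (∈-lookup j) eq)
Unique-lookup-injective (x∉ ∷ _) {suc i} {zero}  eq = ⊥-elim (All.lookup x∉ (∈-lookup i) (sym eq))
Unique-lookup-injective (_  ∷ u) {suc i} {suc j} eq = cong suc (Unique-lookup-injective u eq)

Unique-length≤ : {X : Set} (fin : Finite X) {xs : List X} → Unique xs → length xs ≤ proj₁ fin
Unique-length≤ (_ , Fin↔X) u =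
  Fin.injective⇒≤ (Unique-lookup-injective u ∘ Injection.injective (↔⇒↣ (↔-sym Fin↔X)))

module _ {A : Set} where

  ++-equidivisible : ∀ (as bs cs ds : List A) → as ++ bs ≡ cs ++ ds →
                     (∃ λ xs → cs ≡ as ++ xs × bs ≡ xs ++ ds) ⊎ (∃ λ xs → as ≡ cs ++ xs × ds ≡ xs ++ bs)
  ++-equidivisible []       bs cs       ds eq = inj₁ (cs , refl , eq)
  ++-equidivisible (a ∷ as) bs []       ds eq = inj₂ (a ∷ as , refl , sym eq)
  ++-equidivisible (a ∷ as) bs (c ∷ cs) ds eq with ∷-injective eq
  ... | refl , eq′ with ++-equidivisible as bs cs ds eq′
  ...   | inj₁ (xs , refl , eq″) = inj₁ (xs , refl , eq″)
  ...   | inj₂ (xs , refl , eq″) = inj₂ (xs , refl , eq″)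

  splits? : (P : List A → List A → Set) → (∀ as bs → Dec (P as bs)) →
            ∀ xs → Dec (∃₂ λ as bs → as ++ bs ≡ xs × P as bs)
  splits? P P? [] = map′ (λ p → [] , [] , refl , p) from (P? [] [])
    where
    from : (∃₂ λ as bs → as ++ bs ≡ [] × P as bs) → P [] []
    from ([] , [] , refl , p) = p
  splits? P P? (x ∷ xs) =
    map′ to from (P? [] (x ∷ xs) ⊎-dec splits? (P ∘ (x ∷_)) (P? ∘ (x ∷_)) xs)
    where
    to : P [] (x ∷ xs) ⊎ (∃₂ λ as bs → as ++ bs ≡ xs × P (x ∷ as) bs) →
         ∃₂ λ as bs → as ++ bs ≡ x ∷ xs × P as bs
    to (inj₁ p)                     = [] , x ∷ xs , refl , p
    to (inj₂ (as , bs , refl , p)) = x ∷ as , bs , refl , p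
    from : (∃₂ λ as bs → as ++ bs ≡ x ∷ xs × P as bs) →
           P [] (x ∷ xs) ⊎ (∃₂ λ as bs → as ++ bs ≡ xs × P (x ∷ as) bs)
    from ([]     , _  , refl , p) = inj₁ p
    from (_ ∷ as , bs , refl , p) = inj₂ (as , bs , refl , p)

  Unique-++⁻ : ∀ xs {ys : List A} → Unique (xs ++ ys) → Unique xs × Unique ys
  Unique-++⁻ []       u       = [] , u
  Unique-++⁻ (x ∷ xs) (x∉ ∷ u) with Unique-++⁻ xs u
  ... | uxs , uys = All.++⁻ˡ xs x∉ ∷ uxs , uys

  map-≡-[] : {B : Set} {f : A → B} (xs : List A) → map f xs ≡ [] → xs ≡ []
  map-≡-[] [] _ = refl

module _ {A B : Set} (f : A → B) where

  ++-≡-map : ∀ xs {ys zs} → ys ++ zs ≡ map f xs →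
             ∃₂ λ ys′ zs′ → xs ≡ ys′ ++ zs′ × map f ys′ ≡ ys × map f zs′ ≡ zs
  ++-≡-map xs       {[]}     eq = [] , xs , refl , refl , sym eq
  ++-≡-map (x ∷ xs) {y ∷ ys} eq with ∷-injective eq
  ... | refl , eq′ with ++-≡-map xs {ys} eq′
  ...   | ys′ , zs′ , refl , refl , refl = x ∷ ys′ , zs′ , refl , refl , refl

  concat-≡-map : ∀ xss {ys} → concat xss ≡ map f ys →
                 ∃ λ yss → ys ≡ concat yss × xss ≡ map (map f) yss
  concat-≡-map []         {[]} _  = [] , refl , refl
  concat-≡-map (xs ∷ xss) {ys} eq with ++-≡-map ys {xs} eq
  ... | ys₁ , ys₂ , refl , refl , eq′ with concat-≡-map xss (sym eq′)
  ...   | yss , refl , refl = ys₁ ∷ yss , refl , refl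

module _ (G : Graph) where

  variables : List (E G) → List ℕ
  variables = mapMaybe (varOf G)

  ReadOncePartition : ℕ → List (E G) → Set
  ReadOncePartition k es =
    Σ[ ps ∈ List (List (E G)) ] (concat ps ≡ es × length ps ≤ k × All (ReadOnceList G) ps)

  readOnce? : Decidable (ReadOnceList G)
  readOnce? = unique? ∘ variables

  readOnce-++⁻ˡ : ∀ xs {ys} → ReadOnceList G (xs ++ ys) → ReadOnceList G xs
  readOnce-++⁻ˡ xs {ys} r = proj₁ (Unique-++⁻ (variables xs) (subst Unique (mapMaybe-++ (varOf G) xs ys) r))

  readOnce-++⁻ʳ : ∀ xs {ys} → ReadOnceList G (xs ++ ys) → ReadOnceList G ys
  readOnce-++⁻ʳ xs {ys} r = proj₂ (Unique-++⁻ (variables xs) (subst Unique (mapMaybe-++ (varOf G) xs ys) r))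

  nonReadOnce⇒≢[] : ∀ {es} → ¬ ReadOnceList G es → es ≢ []
  nonReadOnce⇒≢[] ¬ro refl = ¬ro []

  variables-unlabelled : ∀ {e} → lab G e ≡ nothing → variables (e ∷ []) ≡ []
  variables-unlabelled {e} unlabelled with lab G e
  variables-unlabelled refl | nothing = refl

  readOnce-insert-unlabelled : ∀ {e} xs ys → lab G e ≡ nothing →
                               ReadOnceList G (xs ++ ys) → ReadOnceList G (xs ++ e ∷ ys)
  readOnce-insert-unlabelled {e} xs ys unlabelled = subst Unique (sym variables-insert)
    where
    open ≡-Reasoning
    variables-insert : variables (xs ++ e ∷ ys) ≡ variables (xs ++ ys)
    variables-insert = begin
      variables (xs ++ (e ∷ []) ++ ys)                  ≡⟨ mapMaybe-++ (varOf G) xs _ ⟩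
      variables xs ++ variables ((e ∷ []) ++ ys)        ≡⟨ cong (variables xs ++_) (mapMaybe-++ (varOf G) (e ∷ []) ys) ⟩
      variables xs ++ variables (e ∷ []) ++ variables ys ≡⟨ cong (λ zs → variables xs ++ zs ++ variables ys) (variables-unlabelled unlabelled) ⟩
      variables xs ++ variables ys                      ≡⟨ mapMaybe-++ (varOf G) xs ys ⟨
      variables (xs ++ ys)                              ∎

  varCount-++ : ∀ x xs ys → varCount G x (xs ++ ys) ≡ varCount G x xs + varCount G x ys
  varCount-++ x []       ys = refl
  varCount-++ x (e ∷ xs) ys with varOf G e
  ... | nothing = varCount-++ x xs ys
  ... | just y with x ≟ y
  ...   | yes _ = cong suc (varCount-++ x xs ys)
  ...   | no  _ = varCount-++ x xs ys

  varCount-infix : ∀ x as bs cs → varCount G x bs ≤ varCount G x (as ++ bs ++ cs)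
  varCount-infix x as bs cs = begin
    varCount G x bs                                ≤⟨ m≤m+n _ _ ⟩
    varCount G x bs + varCount G x cs              ≡⟨ varCount-++ x bs cs ⟨
    varCount G x (bs ++ cs)                        ≤⟨ m≤n+m _ _ ⟩
    varCount G x as + varCount G x (bs ++ cs)      ≡⟨ varCount-++ x as (bs ++ cs) ⟨
    varCount G x (as ++ bs ++ cs)                  ∎
    where open ≤-Reasoning

  varCount-absent : ∀ x es → All (x ≢_) (variables es) → varCount G x es ≡ 0
  varCount-absent x []       _ = refl
  varCount-absent x (e ∷ es) x∉ with varOf G e
  ... | nothing = varCount-absent x es x∉
  ... | just y with x ≟ y
  ...   | yes x≡y = ⊥-elim (All.head x∉ x≡y)
  ...   | no  _   = varCount-absent x es (All.tail x∉)

  varCount-readOnce : ∀ x es → ReadOnceList G es → varCount G x es ≤ 1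
  varCount-readOnce x []       _ = z≤n
  varCount-readOnce x (e ∷ es) u with varOf G e
  ... | nothing = varCount-readOnce x es u
  ... | just y with x ≟ y | u
  ...   | yes refl | x∉ ∷ _ = s≤s (≤-reflexive (varCount-absent x es x∉))
  ...   | no  _    | _ ∷ u′ = varCount-readOnce x es u′

  partition-varCount : ∀ x {k es} → ReadOncePartition k es → varCount G x es ≤ k
  partition-varCount x (ps , refl , l , rs) = ≤-trans (pieces ps rs) l
    where
    pieces : ∀ ps → All (ReadOnceList G) ps → varCount G x (concat ps) ≤ length ps
    pieces []       []       = z≤n
    pieces (p ∷ ps) (r ∷ rs) = begin
      varCount G x (p ++ concat ps)                 ≡⟨ varCount-++ x p (concat ps) ⟩
      varCount G x p + varCount G x (concat ps)     ≤⟨ +-mono-≤ (varCount-readOnce x p r) (pieces ps rs) ⟩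
      suc (length ps)                               ∎
      where open ≤-Reasoning

  partition-nonReadOnce : ∀ {k es} → ReadOncePartition k es → ¬ ReadOnceList G es → 2 ≤ k
  partition-nonReadOnce ([]        , refl , _ , _)      ¬ro = ⊥-elim (¬ro [])
  partition-nonReadOnce (p ∷ []    , refl , _ , r ∷ []) ¬ro =
    ⊥-elim (¬ro (subst (ReadOnceList G) (sym (++-identityʳ p)) r))
  partition-nonReadOnce (_ ∷ _ ∷ _ , _    , l , _)      _   = ≤-trans (s≤s (s≤s z≤n)) l

  partition? : ∀ k es → Dec (ReadOncePartition k es)
  partition? zero    []       = yes ([] , refl , z≤n , [])
  partition? zero    (e ∷ es) = no λ { ([] , () , _) ; (_ ∷ _ , _ , () , _) }
  partition? (suc k) es       =
    map′ to from (splits? (λ as bs → ReadOnceList G as × ReadOncePartition k bs)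
                          (λ as bs → readOnce? as ×-dec partition? k bs) es)
    where
    to : (∃₂ λ as bs → as ++ bs ≡ es × ReadOnceList G as × ReadOncePartition k bs) → ReadOncePartition (suc k) es
    to (as , bs , refl , r , (ps , refl , l , rs)) = as ∷ ps , refl , s≤s l , r ∷ rs
    from : ReadOncePartition (suc k) es → ∃₂ λ as bs → as ++ bs ≡ es × ReadOnceList G as × ReadOncePartition k bs
    from ([]     , c , _     , _)      = [] , [] , c , [] , ([] , refl , z≤n , [])
    from (p ∷ ps , c , s≤s l , r ∷ rs) = p , concat ps , c , r , (ps , refl , l , rs)

  partition-cons-unlabelled : ∀ {e k es} → lab G e ≡ nothing → 1 ≤ k →
                              ReadOncePartition k es → ReadOncePartition k (e ∷ es)
  partition-cons-unlabelled unlabelled 1≤k ([] , refl , _ , []) =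
    (_ ∷ []) ∷ [] , refl , 1≤k , readOnce-insert-unlabelled [] [] unlabelled [] ∷ []
  partition-cons-unlabelled unlabelled _ (p ∷ ps , refl , l , r ∷ rs) =
    (_ ∷ p) ∷ ps , refl , l , readOnce-insert-unlabelled [] p unlabelled r ∷ rs

  partition-suffix : ∀ {k} ps as {bs} → concat ps ≡ as ++ bs → length ps ≤ k →
                     All (ReadOnceList G) ps → ReadOncePartition k bs
  partition-suffix []       []      eq _ _ = [] , eq , z≤n , []
  partition-suffix (p ∷ ps) as {bs} eq l (r ∷ rs) with ++-equidivisible p (concat ps) as bs eq
  ... | inj₁ (xs , refl , eq′) = partition-suffix ps xs eq′ (≤-trans (n≤1+n _) l) rs
  ... | inj₂ (xs , refl , refl) = xs ∷ ps , refl , l , readOnce-++⁻ʳ as r ∷ rs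

  -- The first piece cannot cover as together with the first edge of bs, so it lies within as.
  partition-drop : ∀ {k} as {bs} → ReadOncePartition k (as ++ bs) →
                   ¬ ReadOnceList G (as ++ take 1 bs) → ReadOncePartition (k ∸ 1) bs
  partition-drop [] {[]} ([] , _ , _) ¬ro = ⊥-elim (¬ro [])
  partition-drop as {bs} (p ∷ ps , c , l , r ∷ rs) ¬ro with ++-equidivisible p (concat ps) as bs c
  ... | inj₁ (xs , refl , eq)     = partition-suffix ps xs eq (∸-monoˡ-≤ 1 l) rs
  ... | inj₂ ([] , _ , refl)      = ps , refl , ∸-monoˡ-≤ 1 l , rs
  ... | inj₂ (b ∷ xs , refl , refl) =
    ⊥-elim (¬ro (readOnce-++⁻ˡ (as ++ b ∷ []) (subst (ReadOnceList G) (sym (++-assoc as (b ∷ []) xs)) r)))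

module _ {G H : Graph} (f : E G → E H) (varOf-f : ∀ e → varOf G e ≡ varOf H (f e)) where

  variables-map : ∀ es → variables G es ≡ variables H (map f es)
  variables-map es = trans (mapMaybe-cong varOf-f es) (sym (mapMaybe-map (varOf H) f es))

  varCount-map : ∀ x es → varCount G x es ≡ varCount H x (map f es)
  varCount-map x []       = refl
  varCount-map x (e ∷ es) rewrite varOf-f e with varOf H (f e)
  ... | nothing = varCount-map x es
  ... | just y with x ≟ y
  ...   | yes _ = cong suc (varCount-map x es)
  ...   | no  _ = varCount-map x es

  partition-reflect : ∀ {k es} → ReadOncePartition H k (map f es) → ReadOncePartition G k es
  partition-reflect (ps , c , l , rs) with concat-≡-map f ps c
  ... | qs , refl , refl =
    qs , refl , subst (_≤ _) (length-map (map f) qs) l ,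
    All.map (λ {q} r → subst Unique (sym (variables-map q)) r) (All.map⁻ rs)

module _ (G : Graph) where

  edges-++ᴾ : ∀ {a b c} (p : Path G a b) (q : Path G b c) → edges G (_++ᴾ_ G p q) ≡ edges G p ++ edges G q
  edges-++ᴾ nil          q = refl
  edges-++ᴾ (cons e _ p) q = cong (e ∷_) (edges-++ᴾ p q)

  edges-subst : ∀ {a b c} (eq : b ≡ c) (p : Path G a b) → edges G (subst (Path G a) eq p) ≡ edges G p
  edges-subst refl p = refl

  All-verts-last : ∀ {P : V G → Set} {a b} (p : Path G a b) → All P (verts G p) → P b
  All-verts-last nil          (Pb ∷ [])  = Pb
  All-verts-last (cons _ _ p) (_  ∷ Ps) = All-verts-last p Ps

  path-to-vertex : ∀ {a b x} (p : Path G a b) → x ∈ verts G p → Path G a x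
  path-to-vertex nil          (here refl) = nil
  path-to-vertex (cons _ _ _) (here refl) = nil
  path-to-vertex (cons e eq p) (there x∈) = cons e eq (path-to-vertex p x∈)

  initLast : ∀ {a b} (p : Path G a b) → edges G p ≢ [] →
             Σ[ g ∈ E G ] Σ[ p₀ ∈ Path G a (src G g) ] (tgt G g ≡ b × edges G p ≡ edges G p₀ ++ g ∷ [])
  initLast nil                         nonempty = ⊥-elim (nonempty refl)
  initLast (cons e refl nil)           _        = e , nil , refl , refl
  initLast (cons e refl p@(cons _ _ _)) _       with initLast p (λ ())
  ... | g , p₀ , g-tgt , p≡ = g , cons e refl p₀ , g-tgt , cong (e ∷_) p≡

  module _ (_≟E_ : DecidableEquality (E G)) where

    in-edge-unique : ∀ {u g e} → SubdivisionVertex G u → tgt G g ≡ u → tgt G e ≡ u → g ≡ e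
    in-edge-unique {g = g} {e} u-sub g-tgt e-tgt with g ≟E e
    ... | yes g≡e = g≡e
    ... | no  g≢e = ⊥-elim (u-sub (inj₁ (g , e , g≢e , g-tgt , e-tgt)))

    out-edge-unique : ∀ {u g e} → SubdivisionVertex G u → src G g ≡ u → src G e ≡ u → g ≡ e
    out-edge-unique {g = g} {e} u-sub g-src e-src with g ≟E e
    ... | yes g≡e = g≡e
    ... | no  g≢e = ⊥-elim (u-sub (inj₂ (g , e , g≢e , g-src , e-src)))

    path-ends-with : ∀ {a} e → SubdivisionVertex G (tgt G e) → (p : Path G a (tgt G e)) → edges G p ≢ [] →
                     Σ[ p₀ ∈ Path G a (src G e) ] edges G p ≡ edges G p₀ ++ e ∷ []
    path-ends-with e w-sub p nonempty with initLast p nonempty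
    ... | g , p₀ , g-tgt , p≡ with in-edge-unique w-sub g-tgt refl
    ...   | refl = p₀ , p≡

module NBP {Z : Graph} {s t : V Z} (nbp : IsNBP Z s t) where
  open IsNBP nbp

  _≟V_ : DecidableEquality (V Z)
  _≟V_ = finite-≟ finiteV

  verts-unique : ∀ {a b} (p : Path Z a b) → Unique (verts Z p)
  verts-unique nil                  = [] ∷ []
  verts-unique {a} (cons e e-src p) =
    All.¬Any⇒All¬ (verts Z p) (λ a∈ → cycle (acyclic (cons e e-src (path-to-vertex Z p a∈)))) ∷ verts-unique p
    where
    cycle : ∀ {es : List (E Z)} → e ∷ es ≢ []
    cycle ()

  length-edges< : ∀ {a b} (p : Path Z a b) → length (edges Z p) < proj₁ finiteV
  length-edges< p =
    subst (_≤ proj₁ finiteV) (cong suc (length-map (tgt Z) (edges Z p))) (Unique-length≤ finiteV (verts-unique p))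

  path-within? : ∀ k a b → Dec (Σ[ p ∈ Path Z a b ] length (edges Z p) ≤ k)
  path-within? k a b with a ≟V b
  ... | yes refl = yes (nil , z≤n)
  path-within? zero    a b | no a≢b = no λ { (nil , _) → a≢b refl ; (cons _ _ _ , ()) }
  path-within? (suc k) a b | no a≢b =
    map′ to from (finite-∃? finiteE (λ e → (src Z e ≟V a) ×-dec path-within? k (tgt Z e) b))
    where
    to : (∃ λ e → src Z e ≡ a × Σ[ p ∈ Path Z (tgt Z e) b ] length (edges Z p) ≤ k) →
         Σ[ p ∈ Path Z a b ] length (edges Z p) ≤ suc k
    to (e , e-src , p , l) = cons e e-src p , s≤s l
    from : (Σ[ p ∈ Path Z a b ] length (edges Z p) ≤ suc k) →
           ∃ λ e → src Z e ≡ a × Σ[ p ∈ Path Z (tgt Z e) b ] length (edges Z p) ≤ k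
    from (nil            , _)     = ⊥-elim (a≢b refl)
    from (cons e e-src p , s≤s l) = e , e-src , p , l

  path? : ∀ a b → Dec (Path Z a b)
  path? a b = map′ proj₁ (λ p → p , ≤-trans (n≤1+n _) (length-edges< p)) (path-within? (proj₁ finiteV) a b)

  path-to-sink : ∀ a → Path Z a t
  path-to-sink a = extend (proj₁ finiteV) a length-edges<
    where
    extend : ∀ k b → (∀ {c} (p : Path Z b c) → length (edges Z p) < k) → Path Z b t
    extend zero    b bounded with () ← bounded nil
    extend (suc k) b bounded with finite-∃? finiteE (λ e → src Z e ≟V b)
    ... | yes (e , refl) = cons e refl (extend k (tgt Z e) (λ p → ≤-pred (bounded (cons e refl p))))
    ... | no  no-out     = subst (Path Z b) (t-unique b (λ e e-src → no-out (e , e-src))) nil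

module _ {d : ℕ} {Z : Graph} {s t : V Z} (Z-smnbp : IsSMNBP Z d s t) (Z-subdivided : Subdivided Z) where
  open IsSMNBP Z-smnbp
  open IsNBP nbp

  private
    _≟E_ : DecidableEquality (E Z)
    _≟E_ = finite-≟ finiteE

    no-junction-edge : ∀ e → ¬ (Junction Z (src Z e) × Junction Z (tgt Z e))
    no-junction-edge = proj₁ Z-subdivided

    labelled-subdivision : ∀ e ℓ → lab Z e ≡ just ℓ → SubdivisionVertex Z (src Z e) × SubdivisionVertex Z (tgt Z e)
    labelled-subdivision = proj₂ Z-subdivided

  -- If the pre-pivot were a junction, the pivot would be a subdivision vertex entered only by the
  -- (necessarily unlabelled) pivot edge, so every path to the pivot would be read-once.
  pre-pivot-subdivision : ∀ e → ReadOnceVertex Z s (src Z e) → (Q : Path Z s (tgt Z e)) → ¬ ReadOncePath Z Q →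
                          SubdivisionVertex Z (src Z e)
  pre-pivot-subdivision e v-ro Q ¬Q-ro v-junction = ¬Q-ro Q-ro
    where
    w-subdivision : SubdivisionVertex Z (tgt Z e)
    w-subdivision w-junction = no-junction-edge e (v-junction , w-junction)

    e-unlabelled : lab Z e ≡ nothing
    e-unlabelled with lab Z e in e-lab
    ... | nothing = refl
    ... | just ℓ  = ⊥-elim (proj₁ (labelled-subdivision e ℓ e-lab) v-junction)

    Q-ro : ReadOncePath Z Q
    Q-ro with path-ends-with Z _≟E_ e w-subdivision Q (nonReadOnce⇒≢[] Z ¬Q-ro)
    ... | Q₀ , Q≡ = subst (ReadOnceList Z) (sym Q≡)
      (readOnce-insert-unlabelled Z (edges Z Q₀) [] e-unlabelled
        (subst (ReadOnceList Z) (sym (++-identityʳ (edges Z Q₀))) (v-ro Q₀)))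

  pivot-tail-partition : ∀ {v w} e → src Z e ≡ v → tgt Z e ≡ w → ReadOnceVertex Z s v →
                         (Q : Path Z s w) → ¬ ReadOncePath Z Q →
                         (T : Path Z v t) → ReadOncePartition Z (d ∸ 1) (edges Z T)
  pivot-tail-partition e refl refl v-ro Q ¬Q-ro nil = [] , refl , z≤n , []
  pivot-tail-partition e refl refl v-ro Q ¬Q-ro (cons f f-src T)
    with out-edge-unique Z _≟E_ (pre-pivot-subdivision e v-ro Q ¬Q-ro) f-src refl
  ... | refl with lab Z e in e-lab
  ...   | nothing = partition-cons-unlabelled Z e-lab (∸-monoˡ-≤ 1 (partition-nonReadOnce Z ρ ¬Q·T-ro))
                      (partition-drop Z (edges Z Q) ρ (¬Q-ro ∘ readOnce-++⁻ˡ Z (edges Z Q)))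
    where
    ρ : ReadOncePartition Z d (edges Z Q ++ edges Z T)
    ρ = subst (ReadOncePartition Z d) (edges-++ᴾ Z Q T) (partition (_++ᴾ_ Z Q T))
    ¬Q·T-ro : ¬ ReadOnceList Z (edges Z Q ++ edges Z T)
    ¬Q·T-ro = ¬Q-ro ∘ readOnce-++⁻ˡ Z (edges Z Q)
  ...   | just ℓ with path-ends-with Z _≟E_ e (proj₂ (labelled-subdivision e ℓ e-lab)) Q (nonReadOnce⇒≢[] Z ¬Q-ro)
  ...     | Q₀ , Q≡ = partition-drop Z (edges Z Q₀) ρ (¬Q-ro ∘ subst (ReadOnceList Z) (sym Q≡))
    where
    ρ : ReadOncePartition Z d (edges Z Q₀ ++ e ∷ edges Z T)
    ρ = subst (ReadOncePartition Z d) (edges-++ᴾ Z Q₀ (cons e refl T)) (partition (_++ᴾ_ Z Q₀ (cons e refl T)))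

  -- The partition is decidable, so it suffices to refute its absence; that absence would make every
  -- path to the pivot read-once.
  pivot-split-tail-partition : ∀ {P : Path Z s t} {v w} → PivotSplit Z P v w →
                               (T : Path Z v t) → ReadOncePartition Z (d ∸ 1) (edges Z T)
  pivot-split-tail-partition sp T =
    decidable-stable (partition? Z (d ∸ 1) (edges Z T)) λ ¬ρ →
      pivotNRO λ Q → decidable-stable (readOnce? Z (edges Z Q)) λ ¬Q-ro →
        ¬ρ (pivot-tail-partition e e-src e-tgt (All-verts-last Z P₁ before) Q ¬Q-ro T)
    where open PivotSplit sp

module _ (Z : Graph) (v : V Z) where

  project : ∀ {a b} → Path (Sub Z v) a b → Path Z (proj₁ a) (proj₁ b)
  project nil                = nil
  project (cons (e , _) eq p) = cons e (cong proj₁ eq) (project p)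

  edges-project : ∀ {a b} (p : Path (Sub Z v) a b) → edges Z (project p) ≡ map proj₁ (edges (Sub Z v) p)
  edges-project nil                = refl
  edges-project (cons (e , _) _ p) = cong (e ∷_) (edges-project p)

  varOf-Sub : ∀ x → varOf (Sub Z v) x ≡ varOf Z (proj₁ x)
  varOf-Sub (e , _) with lab Z e
  ... | nothing = refl
  ... | just _  = refl

  Junction-Sub : ∀ {u} → Junction (Sub Z v) u → Junction Z (proj₁ u)
  Junction-Sub (inj₁ ((e₁ , r₁) , (e₂ , r₂) , e₁≢e₂ , t₁ , t₂)) =
    inj₁ (e₁ , e₂ , (λ eq → e₁≢e₂ (Σ-irrelevant-≡ eq r₁ r₂)) , cong proj₁ t₁ , cong proj₁ t₂)
  Junction-Sub (inj₂ ((e₁ , r₁) , (e₂ , r₂) , e₁≢e₂ , s₁ , s₂)) =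
    inj₂ (e₁ , e₂ , (λ eq → e₁≢e₂ (Σ-irrelevant-≡ eq r₁ r₂)) , cong proj₁ s₁ , cong proj₁ s₂)

  Sub-subdivided : Subdivided Z → Subdivided (Sub Z v)
  Sub-subdivided (no-junction-edge , labelled-subdivision) =
    (λ (e , _) (j₁ , j₂) → no-junction-edge e (Junction-Sub j₁ , Junction-Sub j₂)) ,
    (λ (e , _) ℓ e-lab → Product.map (_∘ Junction-Sub) (_∘ Junction-Sub) (labelled-subdivision e ℓ e-lab))

  module _ {s t : V Z} (Z-nbp : IsNBP Z s t) where
    open IsNBP Z-nbp
    open NBP Z-nbp

    edge-into-root : ∀ e → Path Z v (src Z e) → tgt Z e ≢ v
    edge-into-root e r e-tgt with ++-conicalʳ (edges Z r) (e ∷ []) (begin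
      edges Z r ++ e ∷ []                                     ≡⟨ edges-++ᴾ Z r (cons e refl nil) ⟨
      edges Z (_++ᴾ_ Z r (cons e refl nil))                   ≡⟨ edges-subst Z e-tgt _ ⟨
      edges Z (subst (Path Z v) e-tgt (_++ᴾ_ Z r (cons e refl nil))) ≡⟨ acyclic _ ⟩
      []                                                      ∎)
      where open ≡-Reasoning
    ... | ()

    edge-into-reachable : ∀ {y} (r : Path Z v y) → y ≢ v → ∃ λ (g : E (Sub Z v)) → proj₁ (tgt (Sub Z v) g) ≡ y
    edge-into-reachable nil                y≢v = ⊥-elim (y≢v refl)
    edge-into-reachable r@(cons _ _ _) _ with initLast Z r (λ ())
    ... | g , r₀ , g-tgt , _ = (g , [ r₀ ]) , g-tgt

    Sub-nbp : (r : Path Z v t) → IsNBP (Sub Z v) (v , [ nil ]) (t , [ r ])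
    Sub-nbp _ = record
      { finiteV  = Σ-irrelevant-finite finiteV (path? v)
      ; finiteE  = Σ-irrelevant-finite finiteE (path? v ∘ src Z)
      ; acyclic  = λ p → map-≡-[] (edges (Sub Z v) p) (trans (sym (edges-project p)) (acyclic (project p)))
      ; s-source = λ { (e , [ r ]) eq → ⊥-elim-irr (edge-into-root e r (cong proj₁ eq)) }
      ; s-unique = λ { (y , [ r ]) no-in → root-unique y r no-in }
      ; t-sink   = λ (e , _) eq → t-sink e (cong proj₁ eq)
      ; t-unique = λ { (y , [ r ]) no-out → Σ-irrelevant-≡ (t-unique y (λ f f-src →
                       no-out (f , [ subst (Path Z v) (sym f-src) r ]) (Σ-irrelevant-≡ f-src _ _))) _ _ }
      }
      where
      root-unique : ∀ y .(r : Path Z v y) → (∀ x → tgt (Sub Z v) x ≢ (y , [ r ])) →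
                    _≡_ {A = V (Sub Z v)} (y , [ r ]) (v , [ nil ])
      root-unique y r no-in with y ≟V v
      ... | yes y≡v = Σ-irrelevant-≡ y≡v _ _
      ... | no  y≢v = ⊥-elim-irr (no-in′ (edge-into-reachable r y≢v))
        where
        no-in′ : (∃ λ (g : E (Sub Z v)) → proj₁ (tgt (Sub Z v) g) ≡ y) → ⊥
        no-in′ (g , g-tgt) = no-in g (Σ-irrelevant-≡ g-tgt _ _)

  Sub-smnbp : ∀ {d k s t} → IsSMNBP Z d s t →
              ((T : Path Z v t) → ReadOncePartition Z k (edges Z T)) →
              (r : Path Z v t) → IsSMNBP (Sub Z v) k (v , [ nil ]) (t , [ r ])
  Sub-smnbp {k = k} {t = t} Z-smnbp tail-partition r = record
    { nbp       = Sub-nbp nbp r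
    ; monotone  = λ (e , _) → monotone e
    ; bounded   = λ { {y , [ reach ]} p x →
                    subst (_≤ k) (sym (varCount-Sub x p)) (recompute (_ ≤? k) (bounded-Z reach (project p) x)) }
    ; partition = λ p → partition-reflect {G = Sub Z v} {H = Z} proj₁ varOf-Sub
                          (subst (ReadOncePartition Z k) (edges-project p) (tail-partition (project p)))
    }
    where
    open IsSMNBP Z-smnbp using (nbp; monotone)
    open NBP nbp using (path-to-sink)

    varCount-Sub : ∀ x {a b} (p : Path (Sub Z v) a b) →
                   varCount (Sub Z v) x (edges (Sub Z v) p) ≡ varCount Z x (edges Z (project p))
    varCount-Sub x p = trans (varCount-map {G = Sub Z v} {H = Z} proj₁ varOf-Sub x (edges (Sub Z v) p))
                             (cong (varCount Z x) (sym (edges-project p)))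

    bounded-Z : ∀ {y z} → Path Z v y → (q : Path Z y z) → ∀ x → varCount Z x (edges Z q) ≤ k
    bounded-Z {z = z} reach q x = ≤-trans (varCount-infix Z x (edges Z reach) (edges Z q) (edges Z q′))
                                          (partition-varCount Z x ρ)
      where
      q′ : Path Z z t
      q′ = path-to-sink z
      ρ : ReadOncePartition Z k (edges Z reach ++ edges Z q ++ edges Z q′)
      ρ = subst (ReadOncePartition Z k)
                (trans (edges-++ᴾ Z reach _) (cong (edges Z reach ++_) (edges-++ᴾ Z q q′)))
                (tail-partition (_++ᴾ_ Z reach (_++ᴾ_ Z q q′)))

theorem9 : (d : ℕ) → 1 ≤ d → (Z : Graph) (s t : V Z) →
    IsSMNBP Z d s t → Subdivided Z →
    (P : Path Z s t) → ¬ ReadOncePath Z P →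
    (v w : V Z) → (sp : PivotSplit Z P v w) →
    IsSMNBP (Sub Z v) (d ∸ 1) (v , [ nil ]) (t , [ tail Z sp ])
    × Subdivided (Sub Z v)
theorem9 d _ Z s t Z-smnbp Z-subdivided P _ v w sp =
  Sub-smnbp Z v Z-smnbp (pivot-split-tail-partition Z-smnbp Z-subdivided sp) (tail Z sp) ,
  Sub-subdivided Z v Z-subdivided
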